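{- Let $m\ge2$, let $A$ be a set of integers and $x$ an integer with $1\le\min(A)\le\max(A)<x\le m$, let $\mathbf{m}=(k_1,\dots,k_m)$ with $k_i\ge0$, and let $w\in\mathfrak{S}_{\mathbf m}$ contain at least one letter from $A$. Then $\mathrm{Last}_A(\phi_x(w))=\mathrm{Last}_A(w)$, where $\phi_x=\theta_{(m-2)!}^{\,m-x}\circ C^x$.
   Context: $\mathfrak{S}_{\mathbf m}$ is the set of words with exactly $k_i$ copies of $i$. For a word $u$ containing a letter of $B$, $\mathrm{Last}_B(u)$ is the rightmost letter of $u$ in $B$. $C^x$ acts letterwise: $C^x(y)=y-x$ if $y>x$, $y-x+m$ if $y\le x$. For $1\le i\le m-1$, $\theta_i$ acts on a word as follows: replace every factor $(i+1)i$ by a special symbol $\sim$; each maximal factor of the result consisting only of letters $i$ and $i+1$ has the form $i^a(i+1)^b$ ($a,b\ge0$) and is replaced by $i^b(i+1)^a$; then each $\sim$ is replaced back by $(i+1)i$. $\theta_0=\mathrm{id}$, $\theta_{j!}=\theta_j\circ\cdots\circ\theta_1\circ\theta_0$, and $\theta_{(m-2)!}^{k}$ denotes the $k$-fold composition (identity for $k=0$). -}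

module Defs where

open import Data.Nat using (ℕ; zero; suc; _+_; _∸_; _≤_; _<_; _≡ᵇ_; _<ᵇ_)
open import Data.Nat.Properties using (_≟_)
open import Data.Bool using (Bool; true; false; if_then_else_)
open import Data.List using (List; []; _∷_; _++_; replicate; map)
open import Data.Maybe using (Maybe; just; nothing)
open import Data.Fin using (Fin; toℕ)
open import Data.Product using (_×_)
open import Data.List.Relation.Unary.All using (All)
open import Data.List.Membership.DecPropositional _≟_ using (_∈?_)
open import Relation.Nullary.Decidable using (does)
open import Relation.Binary.PropositionalEquality using (_≡_)

Word : Set
Word = List ℕ

occ : ℕ → Word → ℕ
occ i [] = 0
occ i (y ∷ ys) = if i ≡ᵇ y then suc (occ i ys) else occ i ys

-- w ∈ 𝔖_𝐦 for 𝐦 = (k_1,…,k_m), with k given as k : Fin m → ℕ (k (i-1) = k_i):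
-- every letter lies in {1,…,m} and letter i occurs exactly k_i times.
InS : (m : ℕ) → (Fin m → ℕ) → Word → Set
InS m k w = All (λ y → 1 ≤ y × y ≤ m) w
          × ((i : Fin m) → occ (suc (toℕ i)) w ≡ k i)

lastIn : List ℕ → Word → Maybe ℕ
lastIn A [] = nothing
lastIn A (y ∷ ys) with lastIn A ys
... | just z  = just z
... | nothing = if does (y ∈? A) then just y else nothing

Cletter : ℕ → ℕ → ℕ → ℕ
Cletter m x y = if x <ᵇ y then y ∸ x else (y + m) ∸ x

C : ℕ → ℕ → Word → Word
C m x = map (Cletter m x)

-- θ_i : tokens after replacing factors (i+1)i by the special symbol ∼
data Tok : Set where
  sym   : ℕ → Tok
  tilde : Tok

markPairs : ℕ → Word → List Tok
markPairs i [] = []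
markPairs i (a ∷ []) = sym a ∷ []
markPairs i (a ∷ b ∷ rest) =
  if (a ≡ᵇ suc i) Data.Bool.∧ (b ≡ᵇ i)
  then tilde ∷ markPairs i rest
  else sym a ∷ markPairs i (b ∷ rest)

flush : ℕ → ℕ → ℕ → Word
flush i a b = replicate b i ++ replicate a (suc i)

-- scan tokens, accumulating the current maximal {i,i+1}-factor
-- (a = number of i's, b = number of (i+1)'s; such a factor has form i^a(i+1)^b),
-- and restoring each ∼ as (i+1) i.
swapRuns : ℕ → List Tok → ℕ → ℕ → Word
swapRuns i [] a b = flush i a b
swapRuns i (tilde ∷ ts) a b = flush i a b ++ (suc i ∷ i ∷ swapRuns i ts 0 0)
swapRuns i (sym y ∷ ts) a b =
  if y ≡ᵇ i then swapRuns i ts (suc a) b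
  else if y ≡ᵇ suc i then swapRuns i ts a (suc b)
  else flush i a b ++ (y ∷ swapRuns i ts 0 0)

θ : ℕ → Word → Word
θ zero w = w
θ (suc j) w = swapRuns (suc j) (markPairs (suc j) w) 0 0

-- θ_{j!} = θ_j ∘ ⋯ ∘ θ_1 ∘ θ_0
θfact : ℕ → Word → Word
θfact zero w = θ zero w
θfact (suc j) w = θ (suc j) (θfact j w)

iter : ℕ → (Word → Word) → Word → Word
iter zero f w = w
iter (suc k) f w = f (iter k f w)

φ : ℕ → ℕ → Word → Word
φ m x w = iter (m ∸ x) (θfact (m ∸ 2)) (C m x w)

{-# OPTIONS --safe #-}
-- Write Last_A u as lastJust (inA A) u, the last non-nothing value of a classifier along u.
-- If g (i+1) = nothing, θ_i only changes which letter of each maximal block i^a (i+1)^b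
-- g sees, so lastJust g ∘ θ_i = lastJust (g ∘ (i i+1)). Thus θ_{(m-2)!} acts as
-- precomposition with the cycle 1 ↦ m-1, z ↦ z-1 (2 ≤ z ≤ m-1), which turns the classifier
-- z ↦ inA A (z ∸ j) into z ↦ inA A (z ∸ (j+1)) as long as x + j < m. After m-x steps the
-- accumulated shift m-x undoes C^x on every letter.
module Submission where

open import Defs hiding (sym)
open import Data.Nat using (ℕ; _≤_; _<_)
open import Data.Fin using (Fin)
open import Data.Product using (_×_)
open import Data.List using (List)
open import Data.List.Relation.Unary.All using (All)
open import Data.List.Relation.Unary.Any using (Any)
open import Data.List.Membership.Propositional using (_∈_)
open import Relation.Binary.PropositionalEquality using (_≡_)

open import Data.Nat using (zero; suc; _∸_; _+_; _≡ᵇ_; _<ᵇ_; s≤s; _<?_)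
open import Data.Nat.Properties
open import Data.Bool using (true; false; if_then_else_)
open import Data.Bool.Properties using (T-≡)
open import Data.List using ([]; _∷_; _++_; replicate; map)
open import Data.Maybe using (Maybe; just; nothing; _<∣>_)
open import Data.Maybe.Properties using (<∣>-assoc; <∣>-identityʳ; <∣>-idem)
open import Data.Product using (_,_; proj₂)
open import Data.Sum using (_⊎_; inj₁; inj₂)
open import Data.Unit using (tt)
open import Function using (_∘_; Equivalence)
open import Relation.Nullary using (yes; no; contradiction)
open import Relation.Nullary.Decidable using (does)
open import Data.List.Membership.DecPropositional _≟_ using (_∈?_)
import Data.List.Relation.Unary.All as All
open import Relation.Binary.PropositionalEquality
  using (_≢_; refl; sym; trans; cong; cong₂; subst; module ≡-Reasoning)

open ≡-Reasoning

lastJust : (ℕ → Maybe ℕ) → Word → Maybe ℕ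
lastJust f [] = nothing
lastJust f (y ∷ ys) = lastJust f ys <∣> f y

lastJust-++ : ∀ f u v → lastJust f (u ++ v) ≡ lastJust f v <∣> lastJust f u
lastJust-++ f [] v = sym (<∣>-identityʳ (lastJust f v))
lastJust-++ f (y ∷ u) v = begin
  lastJust f (u ++ v) <∣> f y                 ≡⟨ cong (_<∣> f y) (lastJust-++ f u v) ⟩
  (lastJust f v <∣> lastJust f u) <∣> f y     ≡⟨ <∣>-assoc (lastJust f v) _ _ ⟩
  lastJust f v <∣> (lastJust f u <∣> f y)     ∎

lastJust-map : ∀ f c u → lastJust f (map c u) ≡ lastJust (f ∘ c) u
lastJust-map f c [] = refl
lastJust-map f c (y ∷ u) = cong (_<∣> f (c y)) (lastJust-map f c u)

lastJust-cong : ∀ {P : ℕ → Set} {f f′ : ℕ → Maybe ℕ} → (∀ z → P z → f z ≡ f′ z)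
  → ∀ {u} → All P u → lastJust f u ≡ lastJust f′ u
lastJust-cong f≡f′ All.[] = refl
lastJust-cong f≡f′ {y ∷ _} (py All.∷ pu) = cong₂ _<∣>_ (lastJust-cong f≡f′ pu) (f≡f′ y py)

lastJust-replicate-nothing : ∀ {f y} → f y ≡ nothing → ∀ a → lastJust f (replicate a y) ≡ nothing
lastJust-replicate-nothing fy≡nothing zero = refl
lastJust-replicate-nothing {f} {y} fy≡nothing (suc a) = begin
  lastJust f (replicate a y) <∣> f y   ≡⟨ cong₂ _<∣>_ (lastJust-replicate-nothing fy≡nothing a) fy≡nothing ⟩
  nothing                              ∎

lastJust-replicate-suc : ∀ f y b → lastJust f (replicate (suc b) y) ≡ f y
lastJust-replicate-suc f y zero = refl
lastJust-replicate-suc f y (suc b) = begin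
  lastJust f (replicate (suc b) y) <∣> f y   ≡⟨ cong (_<∣> f y) (lastJust-replicate-suc f y b) ⟩
  f y <∣> f y                                ≡⟨ <∣>-idem (f y) ⟩
  f y                                        ∎

inA : List ℕ → ℕ → Maybe ℕ
inA A y = if does (y ∈? A) then just y else nothing

lastIn≡lastJust-inA : ∀ A w → lastIn A w ≡ lastJust (inA A) w
lastIn≡lastJust-inA A [] = refl
lastIn≡lastJust-inA A (y ∷ ys) with lastIn A ys | lastIn≡lastJust-inA A ys
... | just z  | eq rewrite sym eq = refl
... | nothing | eq rewrite sym eq = refl

≡ᵇ-true⇒≡ : ∀ a b → (a ≡ᵇ b) ≡ true → a ≡ b
≡ᵇ-true⇒≡ a b eq = ≡ᵇ⇒≡ a b (Equivalence.from T-≡ eq)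

≡ᵇ-refl : ∀ n → (n ≡ᵇ n) ≡ true
≡ᵇ-refl n = Equivalence.to T-≡ (≡⇒≡ᵇ n n refl)

≢⇒≡ᵇ-false : ∀ {a b} → a ≢ b → (a ≡ᵇ b) ≡ false
≢⇒≡ᵇ-false {a} {b} a≢b with a ≡ᵇ b in eq
... | true  = contradiction (≡ᵇ-true⇒≡ a b eq) a≢b
... | false = refl

swap : ℕ → ℕ → ℕ
swap i y = if y ≡ᵇ i then suc i else if y ≡ᵇ suc i then i else y

swap-i : ∀ i → swap i i ≡ suc i
swap-i i rewrite ≡ᵇ-refl i = refl

swap-suc-i : ∀ i → swap i (suc i) ≡ i
swap-suc-i i rewrite ≢⇒≡ᵇ-false {suc i} {i} 1+n≢n | ≡ᵇ-refl i = refl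

swap-other : ∀ i y → y ≢ i → y ≢ suc i → swap i y ≡ y
swap-other i y y≢i y≢1+i rewrite ≢⇒≡ᵇ-false y≢i | ≢⇒≡ᵇ-false y≢1+i = refl

unmark : ℕ → List Tok → Word
unmark i [] = []
unmark i (Tok.sym y ∷ ts) = y ∷ unmark i ts
unmark i (tilde ∷ ts) = suc i ∷ i ∷ unmark i ts

unmark-markPairs : ∀ i w → unmark i (markPairs i w) ≡ w
unmark-markPairs i [] = refl
unmark-markPairs i (a ∷ []) = refl
unmark-markPairs i (a ∷ b ∷ w) = step (unmark-markPairs i w) (unmark-markPairs i (b ∷ w))
  where
  step : unmark i (markPairs i w) ≡ w → unmark i (markPairs i (b ∷ w)) ≡ b ∷ w
       → unmark i (markPairs i (a ∷ b ∷ w)) ≡ a ∷ b ∷ w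
  step ih₂ ih₁ with a ≡ᵇ suc i in a≡1+i | b ≡ᵇ i in b≡i
  ... | true  | true  rewrite ≡ᵇ-true⇒≡ a (suc i) a≡1+i | ≡ᵇ-true⇒≡ b i b≡i =
    cong (λ w′ → suc i ∷ i ∷ w′) ih₂
  ... | true  | false = cong (a ∷_) ih₁
  ... | false | _     = cong (a ∷_) ih₁

module _ (i : ℕ) (g : ℕ → Maybe ℕ) (g[1+i]≡nothing : g (suc i) ≡ nothing) where

  private
    h : ℕ → Maybe ℕ
    h = g ∘ swap i

    h[i]≡nothing : h i ≡ nothing
    h[i]≡nothing = trans (cong g (swap-i i)) g[1+i]≡nothing

    g[i]≡h[1+i] : g i ≡ h (suc i)
    g[i]≡h[1+i] = cong g (sym (swap-suc-i i))

    -- the g-value of the run i^a (i+1)^b once flushed; a is irrelevant as g (i+1) = nothing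
    pending : ℕ → Maybe ℕ
    pending zero    = nothing
    pending (suc _) = g i

    lastJust-flush : ∀ a b → lastJust g (flush i a b) ≡ pending b
    lastJust-flush a b rewrite lastJust-++ g (replicate b i) (replicate a (suc i))
                             | lastJust-replicate-nothing {g} g[1+i]≡nothing a with b
    ... | zero  = refl
    ... | suc b = lastJust-replicate-suc g i b

    absorb : ∀ p b → (p <∣> g i) <∣> pending b ≡ p <∣> g i
    absorb p zero    = <∣>-identityʳ (p <∣> g i)
    absorb p (suc b) = trans (<∣>-assoc p (g i) (g i)) (cong (p <∣>_) (<∣>-idem (g i)))

    lastJust-swapRuns-pending : ∀ ts a b →
      lastJust g (swapRuns i ts a b) ≡ lastJust h (unmark i ts) <∣> pending b
    lastJust-swapRuns-pending [] a b = lastJust-flush a b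
    lastJust-swapRuns-pending (tilde ∷ ts) a b = begin
      lastJust g (flush i a b ++ suc i ∷ i ∷ swapRuns i ts 0 0)
        ≡⟨ lastJust-++ g (flush i a b) _ ⟩
      ((lastJust g (swapRuns i ts 0 0) <∣> g i) <∣> g (suc i)) <∣> lastJust g (flush i a b)
        ≡⟨ cong₂ _<∣>_ restored (lastJust-flush a b) ⟩
      ((L <∣> h i) <∣> h (suc i)) <∣> pending b
        ∎
      where
      L R : Maybe ℕ
      L = lastJust h (unmark i ts)
      R = lastJust g (swapRuns i ts 0 0)
      restored : (R <∣> g i) <∣> g (suc i) ≡ (L <∣> h i) <∣> h (suc i)
      restored = begin
        (R <∣> g i) <∣> g (suc i)   ≡⟨ cong ((R <∣> g i) <∣>_) g[1+i]≡nothing ⟩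
        (R <∣> g i) <∣> nothing     ≡⟨ <∣>-identityʳ (R <∣> g i) ⟩
        R <∣> g i                   ≡⟨ cong₂ _<∣>_ R≡L<∣>h[i] g[i]≡h[1+i] ⟩
        (L <∣> h i) <∣> h (suc i)   ∎
        where
        R≡L<∣>h[i] : R ≡ L <∣> h i
        R≡L<∣>h[i] = trans (lastJust-swapRuns-pending ts 0 0) (cong (L <∣>_) (sym h[i]≡nothing))
    -- Abstracting y ≡ᵇ i (and y ≡ᵇ suc i) also reduces h y = g (swap i y) in the goals
    -- below, to g (suc i), g i and g y respectively.
    lastJust-swapRuns-pending (Tok.sym y ∷ ts) a b with y ≡ᵇ i
    ... | true = begin
      lastJust g (swapRuns i ts (suc a) b)   ≡⟨ lastJust-swapRuns-pending ts (suc a) b ⟩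
      L <∣> pending b                        ≡⟨ cong (_<∣> pending b) (sym (<∣>-identityʳ L)) ⟩
      (L <∣> nothing) <∣> pending b          ≡⟨ cong (λ q → (L <∣> q) <∣> pending b) (sym g[1+i]≡nothing) ⟩
      (L <∣> g (suc i)) <∣> pending b        ∎
      where
      L : Maybe ℕ
      L = lastJust h (unmark i ts)
    ... | false with y ≡ᵇ suc i
    ...   | true = trans (lastJust-swapRuns-pending ts a (suc b)) (sym (absorb (lastJust h (unmark i ts)) b))
    ...   | false = begin
      lastJust g (flush i a b ++ y ∷ swapRuns i ts 0 0)
        ≡⟨ lastJust-++ g (flush i a b) _ ⟩
      (lastJust g (swapRuns i ts 0 0) <∣> g y) <∣> lastJust g (flush i a b)
        ≡⟨ cong₂ _<∣>_ (cong (_<∣> g y) (trans (lastJust-swapRuns-pending ts 0 0) (<∣>-identityʳ _)))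
                       (lastJust-flush a b) ⟩
      (lastJust h (unmark i ts) <∣> g y) <∣> pending b
        ∎

  lastJust-swapRuns : ∀ u → lastJust g (swapRuns i (markPairs i u) 0 0) ≡ lastJust (g ∘ swap i) u
  lastJust-swapRuns u = begin
    lastJust g (swapRuns i (markPairs i u) 0 0)   ≡⟨ lastJust-swapRuns-pending (markPairs i u) 0 0 ⟩
    lastJust h (unmark i (markPairs i u)) <∣> nothing ≡⟨ <∣>-identityʳ _ ⟩
    lastJust h (unmark i (markPairs i u))         ≡⟨ cong (lastJust h) (unmark-markPairs i u) ⟩
    lastJust h u                                  ∎

-- cycle n = swap n ∘ ⋯ ∘ swap 1 sends 1 ↦ n+1 and z ↦ z-1 for 2 ≤ z ≤ n+1.
cycle : ℕ → ℕ → ℕ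
cycle zero    z = z
cycle (suc n) z = swap (suc n) (cycle n z)

lastJust-θfact : ∀ n (g : ℕ → Maybe ℕ) → g (suc n) ≡ nothing
  → ∀ u → lastJust g (θfact n u) ≡ lastJust (g ∘ cycle n) u
lastJust-θfact zero    g g[1+n]≡nothing u = refl
lastJust-θfact (suc n) g g[2+n]≡nothing u = begin
  lastJust g (θ (suc n) (θfact n u))                 ≡⟨ lastJust-swapRuns (suc n) g g[2+n]≡nothing (θfact n u) ⟩
  lastJust (g ∘ swap (suc n)) (θfact n u)           ≡⟨ lastJust-θfact n (g ∘ swap (suc n)) g∘swap[1+n]≡nothing u ⟩
  lastJust (g ∘ swap (suc n) ∘ cycle n) u            ∎
  where
  g∘swap[1+n]≡nothing : g (swap (suc n) (suc n)) ≡ nothing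
  g∘swap[1+n]≡nothing = trans (cong g (swap-i (suc n))) g[2+n]≡nothing

cycle-0 : ∀ n → cycle n 0 ≡ 0
cycle-0 zero    = refl
cycle-0 (suc n) rewrite cycle-0 n = refl

cycle-1 : ∀ n → cycle n 1 ≡ suc n
cycle-1 zero    = refl
cycle-1 (suc n) rewrite cycle-1 n = swap-i (suc n)

cycle-fixed : ∀ n z → suc n < z → cycle n z ≡ z
cycle-fixed zero    z _ = refl
cycle-fixed (suc n) z 2+n<z = begin
  swap (suc n) (cycle n z)   ≡⟨ cong (swap (suc n)) (cycle-fixed n z 1+n<z) ⟩
  swap (suc n) z             ≡⟨ swap-other (suc n) z (>⇒≢ 1+n<z) (>⇒≢ 2+n<z) ⟩
  z                          ∎
  where
  1+n<z : suc n < z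
  1+n<z = <-trans (n<1+n (suc n)) 2+n<z

cycle-pred : ∀ n k → k < n → cycle n (suc (suc k)) ≡ suc k
cycle-pred (suc n) k k<1+n with m≤n⇒m<n∨m≡n (≤-pred k<1+n)
... | inj₁ k<n rewrite cycle-pred n k k<n =
  swap-other (suc n) (suc k) (<⇒≢ (s≤s k<n)) (<⇒≢ (s≤s (m<n⇒m<1+n k<n)))
... | inj₂ refl rewrite cycle-fixed k (suc (suc k)) (n<1+n (suc k)) = swap-suc-i (suc k)

SupportedBelow : ℕ → (ℕ → Maybe ℕ) → Set
SupportedBelow x f = ∀ z → z ≡ 0 ⊎ x ≤ z → f z ≡ nothing

inA-supportedBelow : ∀ {A x} → All (λ a → 1 ≤ a × a < x) A → SupportedBelow x (inA A)
inA-supportedBelow {A} A⊆1…x z z≡0⊎x≤z with z ∈? A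
... | no  _   = refl
... | yes z∈A with All.lookup A⊆1…x z∈A | z≡0⊎x≤z
...   | 1≤z , _   | inj₁ refl = contradiction 1≤z (<-irrefl refl)
...   | _   , z<x | inj₂ x≤z  = contradiction z<x (≤⇒≯ x≤z)

module _ {x : ℕ} {f : ℕ → Maybe ℕ} (supported : SupportedBelow x f) where

  shift-cycle : ∀ n j → x ≤ suc n ∸ j → ∀ z → f (cycle n z ∸ j) ≡ f (z ∸ suc j)
  shift-cycle n j x≤1+n∸j zero rewrite cycle-0 n | 0∸n≡0 j = refl
  shift-cycle n j x≤1+n∸j 1 rewrite cycle-1 n =
    trans (supported _ (inj₂ x≤1+n∸j)) (sym (supported _ (inj₁ (0∸n≡0 j))))
  shift-cycle n j x≤1+n∸j (suc (suc k)) with k <? n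
  ... | yes k<n rewrite cycle-pred n k k<n = refl
  ... | no  k≮n = beyond (≮⇒≥ k≮n)
    where
    beyond : n ≤ k → f (cycle n (suc (suc k)) ∸ j) ≡ f (suc k ∸ j)
    beyond n≤k rewrite cycle-fixed n (suc (suc k)) (s≤s (s≤s n≤k)) =
      trans (supported _ (inj₂ (≤-trans x≤1+n∸j (∸-monoˡ-≤ j (m≤n⇒m≤1+n (s≤s n≤k))))))
            (sym (supported _ (inj₂ (≤-trans x≤1+n∸j (∸-monoˡ-≤ j (s≤s n≤k))))))

  lastJust-θfact-shift : ∀ n j → x ≤ suc n ∸ j → ∀ v
    → lastJust (λ z → f (z ∸ j)) (θfact n v) ≡ lastJust (λ z → f (z ∸ suc j)) v
  lastJust-θfact-shift n j x≤1+n∸j v = begin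
    lastJust (λ z → f (z ∸ j)) (θfact n v)
      ≡⟨ lastJust-θfact n (λ z → f (z ∸ j)) (supported _ (inj₂ x≤1+n∸j)) v ⟩
    lastJust (λ z → f (cycle n z ∸ j)) v
      ≡⟨ lastJust-cong (λ z _ → shift-cycle n j x≤1+n∸j z) (All.universal (λ _ → tt) v) ⟩
    lastJust (λ z → f (z ∸ suc j)) v
      ∎

  shift-C : ∀ m → x ≤ m → ∀ y → y ≤ m → f (Cletter m x y ∸ (m ∸ x)) ≡ f y
  shift-C m x≤m y y≤m with x <ᵇ y in x<ᵇy
  ... | true  = trans (supported _ (inj₁ (m≤n⇒m∸n≡0 (∸-monoˡ-≤ x y≤m))))
                      (sym (supported y (inj₂ (<⇒≤ x<y))))
    where
    x<y : x < y
    x<y = <ᵇ⇒< x y (Equivalence.from T-≡ x<ᵇy)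
  ... | false = cong f (begin
    y + m ∸ x ∸ (m ∸ x)     ≡⟨ cong (_∸ (m ∸ x)) (+-∸-assoc y x≤m) ⟩
    y + (m ∸ x) ∸ (m ∸ x)   ≡⟨ m+n∸n≡m y (m ∸ x) ⟩
    y                       ∎)

iter-comm : ∀ t (f : Word → Word) v → iter t f (f v) ≡ f (iter t f v)
iter-comm zero    f v = refl
iter-comm (suc t) f v = cong f (iter-comm t f v)

iter-shift : ∀ {B : Set} (F : ℕ → Word → B) (f : Word → Word) t
  → (∀ j → j < t → ∀ v → F j (f v) ≡ F (suc j) v)
  → ∀ v → F 0 (iter t f v) ≡ F t v
iter-shift F f zero    step v = refl
iter-shift F f (suc t) step v = begin
  F 0 (f (iter t f v))   ≡⟨ cong (F 0) (sym (iter-comm t f v)) ⟩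
  F 0 (iter t f (f v))   ≡⟨ iter-shift F f t (λ j j<t → step j (m<n⇒m<1+n j<t)) (f v) ⟩
  F t (f v)              ≡⟨ step t (n<1+n t) v ⟩
  F (suc t) v            ∎

x≤1+n∸j : ∀ {n x j} → x ≤ suc (suc n) → j < suc (suc n) ∸ x → x ≤ suc n ∸ j
x≤1+n∸j {n} {x} {j} x≤2+n j<2+n∸x = m+n≤o⇒m≤o∸n x (subst (_≤ suc n) (+-comm j x)
  (≤-pred (m≤o∸n⇒m+n≤o (suc j) x≤2+n j<2+n∸x)))

lemma5p5 : (m : ℕ) → 2 ≤ m → (A : List ℕ) → (x : ℕ)
    → All (λ a → 1 ≤ a × a < x) A → x ≤ m
    → (k : Fin m → ℕ) → (w : Word) → InS m k w
    → Any (λ y → y ∈ A) w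
    → lastIn A (φ m x w) ≡ lastIn A w
lemma5p5 m@(suc (suc n)) (s≤s (s≤s _)) A x A⊆1…x x≤m _ w (letters , _) _ = begin
  lastIn A (φ m x w)                              ≡⟨ lastIn≡lastJust-inA A (φ m x w) ⟩
  lastJust (inA A) (iter t (θfact n) (C m x w))   ≡⟨ iter-shift F (θfact n) t step (C m x w) ⟩
  lastJust (λ z → inA A (z ∸ t)) (C m x w)        ≡⟨ lastJust-map _ (Cletter m x) w ⟩
  lastJust (λ y → inA A (Cletter m x y ∸ t)) w    ≡⟨ lastJust-cong (λ y → shift-C supported m x≤m y)
                                                                   (All.map proj₂ letters) ⟩
  lastJust (inA A) w                              ≡⟨ sym (lastIn≡lastJust-inA A w) ⟩
  lastIn A w                                      ∎
  where
  t : ℕ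
  t = m ∸ x
  supported : SupportedBelow x (inA A)
  supported = inA-supportedBelow A⊆1…x
  F : ℕ → Word → Maybe ℕ
  F j = lastJust (λ z → inA A (z ∸ j))
  step : ∀ j → j < t → ∀ v → F j (θfact n v) ≡ F (suc j) v
  step j j<t = lastJust-θfact-shift supported n j (x≤1+n∸j x≤m j<t)
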